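{- Let $n\ge 3$ be an integer, $r=\lfloor n/2\rfloor$, and for $1\le q\le r$ let $L_q=\{\{i,i\oplus q\}:1\le i\le n\}\subseteq V(F_2(C_n))$. Then: (1) if $n$ is even, $|L_{n/2}|=n/2$ and $|L_q|=n$ for $1\le q<r$; (2) if $n$ is odd, $|L_q|=n$ for $1\le q\le r$; (3) $\{L_1,\dots,L_r\}$ is a partition of $V(F_2(C_n))$; (4) if $n\ge 6$, $3\le q\le r$ and $v=\{i,i\oplus q\}\in L_q$ with $1\le i\le n$, then $v$ has two neighbors $B,C$ in $F_2(C_n)$ that belong to $L_{q-1}$, and the vertex of $N(B)\cap N(C)\setminus\{v\}$ belongs to $L_{q-2}$; (5) for $v\in V(F_2(C_n))$, $v$ has degree $2$ in $F_2(C_n)$ if and only if $v\in L_1$.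
   Context: $C_n$ is the cycle with vertex set $\{1,\dots,n\}$ and edges $\{i,i+1\}$ ($1\le i\le n-1$) and $\{1,n\}$. The $2$-token graph $F_2(C_n)$ has as vertices the $2$-element subsets of $\{1,\dots,n\}$, two being adjacent iff their symmetric difference is an edge of $C_n$. Here $i\oplus j$ denotes $(i+j)\bmod n$ with the convention that the representatives are $1,\dots,n$ (i.e. $n\equiv n$). $N(\cdot)$ denotes the neighborhood in $F_2(C_n)$. -}

module Defs where

open import Data.Nat using (ℕ; zero; suc; _+_)
open import Data.Nat.DivMod using (_mod_)
open import Data.Fin using (Fin; toℕ) renaming (_<_ to _<ᶠ_)
open import Data.Product using (Σ; ∃; ∃-syntax; _×_)
open import Data.Sum using (_⊎_)
open import Data.List using (List; length)
open import Data.List.Membership.Propositional using (_∈_)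
open import Data.List.Relation.Unary.Unique.Propositional using (Unique)
open import Function.Bundles using (_⇔_)
open import Relation.Nullary using (¬_)
open import Relation.Binary.PropositionalEquality using (_≡_; _≢_)

-- Vertices of C_n are represented by Fin n = {0,…,n-1}
-- (the paper's label j ∈ {1,…,n} corresponds to j-1; this relabelling is an
-- automorphism-compatible shift, so i ⊕ q becomes (i + q) mod n).

_⊕_ : ∀ {n} → Fin n → ℕ → Fin n
_⊕_ {suc m} i q = (toℕ i + q) mod (suc m)

CEdge : ∀ {n} → Fin n → Fin n → Set
CEdge x y = (y ≡ x ⊕ 1) ⊎ (x ≡ y ⊕ 1)

-- a 2-element subset {fst, snd} of the vertex set, stored with fst < snd
record Pair (n : ℕ) : Set where
  constructor ⟪_,_,_⟫
  field
    fst : Fin n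
    snd : Fin n
    lt  : fst <ᶠ snd
open Pair public

_∈ᵥ_ : ∀ {n} → Fin n → Pair n → Set
x ∈ᵥ v = (x ≡ fst v) ⊎ (x ≡ snd v)

_∈Δ_,_ : ∀ {n} → Fin n → Pair n → Pair n → Set
z ∈Δ u , v = (z ∈ᵥ u × ¬ (z ∈ᵥ v)) ⊎ (¬ (z ∈ᵥ u) × z ∈ᵥ v)

Adj : ∀ {n} → Pair n → Pair n → Set
Adj {n} u v = ∃[ x ] ∃[ y ] (x ≢ y × CEdge x y ×
                (∀ (z : Fin n) → (z ∈Δ u , v) ⇔ ((z ≡ x) ⊎ (z ≡ y))))

InL : ∀ {n} → ℕ → Pair n → Set
InL {n} q v = ∃[ i ] (∀ (x : Fin n) → x ∈ᵥ v ⇔ ((x ≡ i) ⊎ (x ≡ i ⊕ q)))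

HasCard : ∀ {n} → (Pair n → Set) → ℕ → Set
HasCard {n} P k = Σ (List (Pair n)) λ xs →
  length xs ≡ k × Unique xs × (∀ v → P v ⇔ (v ∈ xs))

HasDegree : ∀ {n} → Pair n → ℕ → Set
HasDegree v d = HasCard (Adj v) d

-- Two vertices of F_2(C_n) are adjacent iff they are {c, x} and {c, y} with xy an edge of C_n,
-- i.e. one token moves one step. Every vertex is {i, i ⊕ q} for exactly one q with
-- 1 ≤ q ≤ n/2 (the cyclic distance of its tokens), so the L_q partition the vertices; L_q
-- consists of the n rotations of {0, q}, which are distinct unless 2q = n, when they coincide
-- in pairs. Moving one token of {i, i ⊕ q} towards the other gives B, C ∈ L_(q−1); moving both
-- gives their only common neighbour besides v, which lies in L_(q−2). A vertex has degree 2 iff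
-- its tokens are adjacent: otherwise each token has two free moves, giving three neighbours.
module Submission where

open import Defs
open import Data.Nat using (ℕ; suc; >-nonZero; _+_; _*_; _∸_; _≤_; _<_; z≤n; s≤s)
open import Data.Nat.Properties
open import Data.Nat.DivMod
open import Data.Nat.Divisibility using (_∣_; divides; ∣⇒≤; m%n≡0⇒n∣m; n∣m⇒m%n≡0)
open import Data.Fin using (Fin; toℕ; fromℕ<; inject≤) renaming (zero to 0ᶠ; _≤_ to _≤ᶠ_)
import Data.Fin.Properties as Fin
open import Data.Product using (∃-syntax; _×_; _,_)
open import Data.Sum using (_⊎_; inj₁; inj₂; [_,_]′; swap)
open import Data.Empty using (⊥; ⊥-elim)
open import Data.List using (List; []; _∷_; length; tabulate)
open import Data.List.Properties using (length-tabulate)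
open import Data.List.Membership.Propositional.Properties using (∈-tabulate⁺; ∈-tabulate⁻)
open import Data.List.Relation.Unary.Unique.Propositional.Properties using (tabulate⁺)
open import Data.List.Membership.Propositional using (_∈_)
open import Data.List.Relation.Unary.Any using (here; there)
open import Data.List.Relation.Unary.All using ([]; _∷_)
open import Data.List.Relation.Unary.AllPairs using ([]; _∷_)
open import Function using (_∘_; id)
open import Function.Bundles using (_⇔_; mk⇔; Equivalence)
open import Relation.Nullary using (¬_; Dec; yes; no)
open import Relation.Nullary.Decidable using (_⊎-dec_)
open import Relation.Binary.Definitions using (tri<; tri≈; tri>)
open import Relation.Binary.PropositionalEquality

open Equivalence using (to; from)

module _ {m : ℕ} where
  private
    N = suc m

  toℕ-⊕ : (i : Fin N) (a : ℕ) → toℕ (i ⊕ a) ≡ (toℕ i + a) % N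
  toℕ-⊕ i a = Fin.toℕ-fromℕ< (m%n<n (toℕ i + a) N)

  toℕ-⊕-< : (i : Fin N) {a : ℕ} → toℕ i + a < N → toℕ (i ⊕ a) ≡ toℕ i + a
  toℕ-⊕-< i {a} lt = trans (toℕ-⊕ i a) (m<n⇒m%n≡m lt)

  ⊕-assoc : (i : Fin N) (a b : ℕ) → (i ⊕ a) ⊕ b ≡ i ⊕ (a + b)
  ⊕-assoc i a b = Fin.toℕ-injective (begin
    toℕ ((i ⊕ a) ⊕ b)              ≡⟨ toℕ-⊕ (i ⊕ a) b ⟩
    (toℕ (i ⊕ a) + b) % N          ≡⟨ cong (λ t → (t + b) % N) (toℕ-⊕ i a) ⟩
    ((toℕ i + a) % N + b) % N      ≡⟨ %-distribˡ-+ ((toℕ i + a) % N) b N ⟩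
    ((toℕ i + a) % N % N + b % N) % N
                                   ≡⟨ cong (λ t → (t + b % N) % N) (m%n%n≡m%n (toℕ i + a) N) ⟩
    ((toℕ i + a) % N + b % N) % N  ≡⟨ %-distribˡ-+ (toℕ i + a) b N ⟨
    (toℕ i + a + b) % N            ≡⟨ cong (_% N) (+-assoc (toℕ i) a b) ⟩
    (toℕ i + (a + b)) % N          ≡⟨ toℕ-⊕ i (a + b) ⟨
    toℕ (i ⊕ (a + b))              ∎)
    where open ≡-Reasoning

  ⊕-identityʳ : (i : Fin N) → i ⊕ 0 ≡ i
  ⊕-identityʳ i = Fin.toℕ-injective (trans (toℕ-⊕-< i i+0<N) (+-identityʳ (toℕ i)))
    where
      i+0<N : toℕ i + 0 < N
      i+0<N = subst (_< N) (sym (+-identityʳ (toℕ i))) (Fin.toℕ<n i)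

  ⊕-period : (i : Fin N) → i ⊕ N ≡ i
  ⊕-period i = Fin.toℕ-injective (begin
    toℕ (i ⊕ N)        ≡⟨ toℕ-⊕ i N ⟩
    (toℕ i + N) % N    ≡⟨ [m+n]%n≡m%n (toℕ i) N ⟩
    toℕ i % N          ≡⟨ m<n⇒m%n≡m (Fin.toℕ<n i) ⟩
    toℕ i              ∎)
    where open ≡-Reasoning

  ⊕-suc : (i : Fin N) (a : ℕ) → (i ⊕ a) ⊕ 1 ≡ i ⊕ suc a
  ⊕-suc i a = trans (⊕-assoc i a 1) (cong (i ⊕_) (+-comm a 1))

  ⊕-pred : (i : Fin N) (a : ℕ) → (i ⊕ suc a) ⊕ m ≡ i ⊕ a
  ⊕-pred i a = begin
    (i ⊕ suc a) ⊕ m   ≡⟨ ⊕-assoc i (suc a) m ⟩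
    i ⊕ (suc a + m)   ≡⟨ cong (i ⊕_) (sym (+-suc a m)) ⟩
    i ⊕ (a + N)       ≡⟨ ⊕-assoc i a N ⟨
    (i ⊕ a) ⊕ N       ≡⟨ ⊕-period (i ⊕ a) ⟩
    i ⊕ a             ∎
    where open ≡-Reasoning

  ⊕-1-m : (i : Fin N) → (i ⊕ 1) ⊕ m ≡ i
  ⊕-1-m i = trans (⊕-assoc i 1 m) (⊕-period i)

  ⊕-m-1 : (i : Fin N) → (i ⊕ m) ⊕ 1 ≡ i
  ⊕-m-1 i = trans (⊕-suc i m) (⊕-period i)

  ⊕-fixed⇒∣ : (i : Fin N) (c : ℕ) → i ⊕ c ≡ i → N ∣ c
  ⊕-fixed⇒∣ i c eq = divides ((toℕ i + c) / N) (+-cancelˡ-≡ (toℕ i) c _ (begin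
    toℕ i + c                                 ≡⟨ m≡m%n+[m/n]*n (toℕ i + c) N ⟩
    (toℕ i + c) % N + (toℕ i + c) / N * N     ≡⟨ cong (_+ (toℕ i + c) / N * N) i⊕c≡i ⟩
    toℕ i + (toℕ i + c) / N * N               ∎))
    where
      open ≡-Reasoning
      i⊕c≡i : (toℕ i + c) % N ≡ toℕ i
      i⊕c≡i = trans (sym (toℕ-⊕ i c)) (cong toℕ eq)

  ⊕-≢-self : (i : Fin N) {c : ℕ} → 0 < c → c < N → i ⊕ c ≢ i
  ⊕-≢-self i {c@(suc _)} _ c<N eq = <⇒≱ c<N (∣⇒≤ (⊕-fixed⇒∣ i c eq))

  ⊕-≢-< : (i : Fin N) {a b : ℕ} → a < b → b < N → i ⊕ a ≢ i ⊕ b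
  ⊕-≢-< i {a} {b} a<b b<N eq =
    ⊕-≢-self (i ⊕ a) (m<n⇒0<n∸m a<b) (≤-<-trans (m∸n≤m b a) b<N) (begin
    (i ⊕ a) ⊕ (b ∸ a)   ≡⟨ ⊕-assoc i a (b ∸ a) ⟩
    i ⊕ (a + (b ∸ a))   ≡⟨ cong (i ⊕_) (m+[n∸m]≡n (<⇒≤ a<b)) ⟩
    i ⊕ b               ≡⟨ eq ⟨
    i ⊕ a               ∎)
    where open ≡-Reasoning

  ⊕-cancelˡ : (i : Fin N) {a b : ℕ} → a < N → b < N → i ⊕ a ≡ i ⊕ b → a ≡ b
  ⊕-cancelˡ i {a} {b} a<N b<N eq with <-cmp a b
  ... | tri< a<b _ _ = ⊥-elim (⊕-≢-< i a<b b<N eq)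
  ... | tri≈ _ a≡b _ = a≡b
  ... | tri> _ _ b<a = ⊥-elim (⊕-≢-< i b<a a<N (sym eq))

  ⊕-≢ : (i : Fin N) {a b : ℕ} → a < N → b < N → a ≢ b → i ⊕ a ≢ i ⊕ b
  ⊕-≢ i a<N b<N a≢b eq = a≢b (⊕-cancelˡ i a<N b<N eq)

module _ (n : ℕ) where

  n≡n%2+half+half : n ≡ n % 2 + (n / 2 + n / 2)
  n≡n%2+half+half = trans (m≡m%n+[m/n]*n n 2) (cong (n % 2 +_) half*2≡half+half)
    where
      half*2≡half+half : n / 2 * 2 ≡ n / 2 + n / 2
      half*2≡half+half = trans (*-comm (n / 2) 2) (cong (n / 2 +_) (+-identityʳ (n / 2)))

  ≤half⇒double≤ : ∀ {q} → q ≤ n / 2 → q + q ≤ n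
  ≤half⇒double≤ q≤ = ≤-trans (+-mono-≤ q≤ q≤)
    (subst (n / 2 + n / 2 ≤_) (sym n≡n%2+half+half) (m≤n+m _ (n % 2)))

  ≤suc-half+half : n ≤ suc (n / 2 + n / 2)
  ≤suc-half+half = subst (_≤ suc (n / 2 + n / 2)) (sym n≡n%2+half+half)
    (+-monoˡ-≤ _ (≤-pred (m%n<n n 2)))

  even⇒half+half≡ : 2 ∣ n → n / 2 + n / 2 ≡ n
  even⇒half+half≡ 2∣n =
    sym (trans n≡n%2+half+half (cong (_+ (n / 2 + n / 2)) (n∣m⇒m%n≡0 n 2 2∣n)))

  <half⇒double< : ∀ {q} → q < n / 2 → q + q < n
  <half⇒double< q<half = <-≤-trans (+-mono-< q<half q<half) (≤half⇒double≤ ≤-refl)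

  odd⇒suc-half+half≡ : ¬ 2 ∣ n → suc (n / 2 + n / 2) ≡ n
  odd⇒suc-half+half≡ 2∤n with n % 2 | m%n<n n 2 | n≡n%2+half+half | m%n≡0⇒n∣m n 2
  ... | 0 | _ | _ | n%2≡0⇒2∣n = ⊥-elim (2∤n (n%2≡0⇒2∣n refl))
  ... | 1 | _ | n≡ | _ = sym n≡
  ... | suc (suc _) | s≤s (s≤s ()) | _ | _

  odd∧≤half⇒double< : ∀ {q} → ¬ 2 ∣ n → q ≤ n / 2 → q + q < n
  odd∧≤half⇒double< 2∤n q≤half =
    ≤-trans (s≤s (+-mono-≤ q≤half q≤half)) (≤-reflexive (odd⇒suc-half+half≡ 2∤n))

double≤⇒< : ∀ {q n} → 0 < q → q + q ≤ n → q < n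
double≤⇒< {q} 0<q 2q≤n = <-≤-trans (m<m+n q 0<q) 2q≤n

halves-≡ : ∀ {a b n} → a + a ≤ n → b + b ≤ n → n ≤ b + a → a ≡ b
halves-≡ {a} {b} 2a≤n 2b≤n n≤b+a with <-cmp a b
... | tri< a<b _ _ = ⊥-elim (<⇒≱ (<-≤-trans (+-monoʳ-< b a<b) 2b≤n) n≤b+a)
... | tri≈ _ a≡b _ = a≡b
... | tri> _ _ b<a = ⊥-elim (<⇒≱ (<-≤-trans (+-monoˡ-< a b<a) 2a≤n) n≤b+a)

record _≐⟨_,_⟩ {n : ℕ} (v : Pair n) (x y : Fin n) : Set where
  constructor ≐-intro
  field elements : ∀ z → z ∈ᵥ v ⇔ ((z ≡ x) ⊎ (z ≡ y))
open _≐⟨_,_⟩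

module _ {n : ℕ} {v : Pair n} {x y : Fin n} where

  ≐-∈ˡ : v ≐⟨ x , y ⟩ → x ∈ᵥ v
  ≐-∈ˡ p = from (elements p x) (inj₁ refl)

  ≐-∈ʳ : v ≐⟨ x , y ⟩ → y ∈ᵥ v
  ≐-∈ʳ p = from (elements p y) (inj₂ refl)

  ≐-∈⁻ : ∀ {z} → v ≐⟨ x , y ⟩ → z ∈ᵥ v → (z ≡ x) ⊎ (z ≡ y)
  ≐-∈⁻ p = to (elements p _)

  ≐-sym : v ≐⟨ x , y ⟩ → v ≐⟨ y , x ⟩
  ≐-sym p = ≐-intro λ z → mk⇔ (swap ∘ ≐-∈⁻ p) (from (elements p z) ∘ swap)

  ≐-congʳ : ∀ {y′} → y ≡ y′ → v ≐⟨ x , y ⟩ → v ≐⟨ x , y′ ⟩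
  ≐-congʳ refl p = p

  ≐-other : ∀ {z} → v ≐⟨ x , y ⟩ → z ∈ᵥ v → z ≢ x → z ≡ y
  ≐-other p z∈v z≢x = [ (λ z≡x → ⊥-elim (z≢x z≡x)) , id ]′ (≐-∈⁻ p z∈v)

  ≐-∉ : ∀ {z} → v ≐⟨ x , y ⟩ → z ≢ x → z ≢ y → ¬ z ∈ᵥ v
  ≐-∉ p z≢x z≢y z∈v = [ z≢x , z≢y ]′ (≐-∈⁻ p z∈v)

  ≐-distinct : v ≐⟨ x , y ⟩ → x ≢ y
  ≐-distinct p refl = Fin.<⇒≢ (lt v) (trans (only-x (inj₁ refl)) (sym (only-x (inj₂ refl))))
    where
      only-x : ∀ {z} → z ∈ᵥ v → z ≡ x
      only-x = [ id , id ]′ ∘ ≐-∈⁻ p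

module _ {n : ℕ} where

  ∈∧∉⇒≢ : ∀ {x} {v w : Pair n} → x ∈ᵥ v → ¬ x ∈ᵥ w → v ≢ w
  ∈∧∉⇒≢ x∈v x∉w refl = x∉w x∈v

  ≐-self : (v : Pair n) → v ≐⟨ fst v , snd v ⟩
  ≐-self v = ≐-intro λ z → mk⇔ id id

  ≐-from : ∀ {v : Pair n} {c d : Fin n} → c ∈ᵥ v → d ∈ᵥ v → c ≢ d → v ≐⟨ c , d ⟩
  ≐-from {v} (inj₁ refl) (inj₁ refl) c≢d = ⊥-elim (c≢d refl)
  ≐-from {v} (inj₁ refl) (inj₂ refl) c≢d = ≐-self v
  ≐-from {v} (inj₂ refl) (inj₁ refl) c≢d = ≐-sym (≐-self v)
  ≐-from {v} (inj₂ refl) (inj₂ refl) c≢d = ⊥-elim (c≢d refl)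

  fst-≤ : (v : Pair n) {z : Fin n} → z ∈ᵥ v → fst v ≤ᶠ z
  fst-≤ v (inj₁ refl) = ≤-refl
  fst-≤ v (inj₂ refl) = <⇒≤ (lt v)

  ≤-snd : (v : Pair n) {z : Fin n} → z ∈ᵥ v → z ≤ᶠ snd v
  ≤-snd v (inj₁ refl) = <⇒≤ (lt v)
  ≤-snd v (inj₂ refl) = ≤-refl

  -- fst and snd are the minimum and the maximum of the elements.
  ≐-unique : ∀ {u w : Pair n} {x y} → u ≐⟨ x , y ⟩ → w ≐⟨ x , y ⟩ → u ≡ w
  ≐-unique {u@(⟪ a , b , a<b ⟫)} {w@(⟪ c , d , c<d ⟫)} p q
    with Fin.≤-antisym (fst-≤ w (u⊆w (inj₁ refl))) (fst-≤ u (w⊆u (inj₁ refl)))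
       | Fin.≤-antisym (≤-snd u (w⊆u (inj₂ refl))) (≤-snd w (u⊆w (inj₂ refl)))
    where
      u⊆w : ∀ {z} → z ∈ᵥ u → z ∈ᵥ w
      u⊆w = from (elements q _) ∘ to (elements p _)
      w⊆u : ∀ {z} → z ∈ᵥ w → z ∈ᵥ u
      w⊆u = from (elements p _) ∘ to (elements q _)
  ... | refl | refl = cong ⟪ a , b ,_⟫ (Fin.<-irrelevant a<b c<d)

  mkPair : (x y : Fin n) → x ≢ y → Pair n
  mkPair x y x≢y with Fin.<-cmp x y
  ... | tri< x<y _ _ = ⟪ x , y , x<y ⟫
  ... | tri≈ _ x≡y _ = ⊥-elim (x≢y x≡y)
  ... | tri> _ _ y<x = ⟪ y , x , y<x ⟫

  mkPair-≐ : (x y : Fin n) (x≢y : x ≢ y) → mkPair x y x≢y ≐⟨ x , y ⟩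
  mkPair-≐ x y x≢y with Fin.<-cmp x y
  ... | tri< x<y _ _ = ≐-self _
  ... | tri≈ _ x≡y _ = ⊥-elim (x≢y x≡y)
  ... | tri> _ _ y<x = ≐-sym (≐-self _)

  _∈ᵥ?_ : (z : Fin n) (v : Pair n) → Dec (z ∈ᵥ v)
  z ∈ᵥ? v = (z Fin.≟ fst v) ⊎-dec (z Fin.≟ snd v)

  other-element : (v : Pair n) (z : Fin n) → ∃[ c ] (c ∈ᵥ v × c ≢ z)
  other-element v z with fst v Fin.≟ z
  ... | yes refl = snd v , inj₂ refl , Fin.<⇒≢ (lt v) ∘ sym
  ... | no fst≢z = fst v , inj₁ refl , fst≢z

  CEdge-sym : {x y : Fin n} → CEdge x y → CEdge y x
  CEdge-sym = swap

  ∈Δ-comm : ∀ {z} {u w : Pair n} → z ∈Δ u , w → z ∈Δ w , u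
  ∈Δ-comm (inj₁ (z∈u , z∉w)) = inj₂ (z∉w , z∈u)
  ∈Δ-comm (inj₂ (z∉u , z∈w)) = inj₁ (z∈w , z∉u)

module _ {n : ℕ} {u w : Pair n} {x y : Fin n}
         (Δ⊆ : ∀ {z} → z ∈Δ u , w → (z ≡ x) ⊎ (z ≡ y)) where

  Δ-common : x ∈ᵥ u → y ∈ᵥ w → ¬ y ∈ᵥ u → ∃[ c ] (u ≐⟨ c , x ⟩ × w ≐⟨ c , y ⟩)
  Δ-common x∈u y∈w y∉u with other-element u x
  ... | c , c∈u , c≢x = c , ≐-from c∈u x∈u c≢x , ≐-from c∈w y∈w c≢y
    where
      c≢y : c ≢ y
      c≢y refl = y∉u c∈u
      c∈w : c ∈ᵥ w
      c∈w with c ∈ᵥ? w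
      ... | yes c∈w = c∈w
      ... | no c∉w = ⊥-elim ([ c≢x , c≢y ]′ (Δ⊆ (inj₁ (c∈u , c∉w))))

  Δ-one-sided : x ≢ y → x ∈ᵥ u → y ∈ᵥ u → ¬ x ∈ᵥ w → ¬ y ∈ᵥ w → ⊥
  Δ-one-sided x≢y x∈u y∈u x∉w y∉w = [ fst≢x , fst≢y ]′ fst-w
    where
      fst≢x : fst w ≢ x
      fst≢x refl = x∉w (inj₁ refl)
      fst≢y : fst w ≢ y
      fst≢y refl = y∉w (inj₁ refl)
      fst-w : (fst w ≡ x) ⊎ (fst w ≡ y)
      fst-w with fst w ∈ᵥ? u
      ... | yes fst∈u = ≐-∈⁻ (≐-from {v = u} x∈u y∈u x≢y) fst∈u
      ... | no fst∉u = Δ⊆ (inj₂ (fst∉u , inj₁ refl))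

module _ {n : ℕ} {u w : Pair n} where

  Adj-elim : Adj u w → ∃[ c ] ∃[ x ] ∃[ y ] (CEdge x y × u ≐⟨ c , x ⟩ × w ≐⟨ c , y ⟩)
  Adj-elim (x , y , x≢y , e , Δ) = cases (from (Δ x) (inj₁ refl)) (from (Δ y) (inj₂ refl))
    where
      Δ⊆ : ∀ {z} → z ∈Δ u , w → (z ≡ x) ⊎ (z ≡ y)
      Δ⊆ {z} = to (Δ z)
      cases : x ∈Δ u , w → y ∈Δ u , w →
              ∃[ c ] ∃[ x ] ∃[ y ] (CEdge x y × u ≐⟨ c , x ⟩ × w ≐⟨ c , y ⟩)
      cases (inj₁ (x∈u , _)) (inj₂ (y∉u , y∈w)) =
        let c , p , q = Δ-common {u = u} {w = w} Δ⊆ x∈u y∈w y∉u in c , x , y , e , p , q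
      cases (inj₂ (x∉u , x∈w)) (inj₁ (y∈u , _)) =
        let c , p , q = Δ-common {u = u} {w = w} (swap ∘ Δ⊆) y∈u x∈w x∉u
        in c , y , x , CEdge-sym e , p , q
      cases (inj₁ (x∈u , x∉w)) (inj₁ (y∈u , y∉w)) =
        ⊥-elim (Δ-one-sided {u = u} {w = w} Δ⊆ x≢y x∈u y∈u x∉w y∉w)
      cases (inj₂ (x∉u , x∈w)) (inj₂ (y∉u , y∈w)) =
        ⊥-elim (Δ-one-sided {u = w} {w = u} (Δ⊆ ∘ ∈Δ-comm {u = w} {w = u})
                            x≢y x∈w y∈w x∉u y∉u)

  Adj-intro : ∀ {c x y} → CEdge x y → x ≢ y → u ≐⟨ c , x ⟩ → w ≐⟨ c , y ⟩ → Adj u w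
  Adj-intro {c} {x} {y} e x≢y p q = x , y , x≢y , e , λ z → mk⇔ Δ⊆ ⊆Δ
    where
      Δ⊆ : ∀ {z} → z ∈Δ u , w → (z ≡ x) ⊎ (z ≡ y)
      Δ⊆ (inj₁ (z∈u , z∉w)) = inj₁ (≐-other p z∈u λ { refl → z∉w (≐-∈ˡ q) })
      Δ⊆ (inj₂ (z∉u , z∈w)) = inj₂ (≐-other q z∈w λ { refl → z∉u (≐-∈ˡ p) })
      ⊆Δ : ∀ {z} → (z ≡ x) ⊎ (z ≡ y) → z ∈Δ u , w
      ⊆Δ (inj₁ refl) = inj₁ (≐-∈ʳ p , ≐-∉ q (≐-distinct p ∘ sym) x≢y)
      ⊆Δ (inj₂ refl) = inj₂ (≐-∉ p (≐-distinct q ∘ sym) (x≢y ∘ sym) , ≐-∈ʳ q)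

  Adj-cases : ∀ {a b} → u ≐⟨ a , b ⟩ → Adj u w →
              ∃[ y ] ((CEdge b y × w ≐⟨ a , y ⟩) ⊎ (CEdge a y × w ≐⟨ b , y ⟩))
  Adj-cases {a} {b} p adj with Adj-elim adj
  ... | c , x , y , e , pu , pw = cases (≐-∈⁻ p (≐-∈ˡ pu))
    where
      x∈u : x ∈ᵥ u
      x∈u = ≐-∈ʳ pu
      x≢c : x ≢ c
      x≢c = ≐-distinct pu ∘ sym
      cases : (c ≡ a) ⊎ (c ≡ b) →
              ∃[ y ] ((CEdge b y × w ≐⟨ a , y ⟩) ⊎ (CEdge a y × w ≐⟨ b , y ⟩))
      cases (inj₁ refl) = y , inj₁ (subst (λ x → CEdge x y) (≐-other p x∈u x≢c) e , pw)
      cases (inj₂ refl) = y , inj₂ (subst (λ x → CEdge x y) (≐-other (≐-sym p) x∈u x≢c) e , pw)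

  Adj-common : Adj u w → ∃[ c ] (c ∈ᵥ u × c ∈ᵥ w)
  Adj-common adj with Adj-elim adj
  ... | c , _ , _ , _ , pu , pw = c , ≐-∈ˡ pu , ≐-∈ˡ pw

  ≐-disjoint : ∀ {x y x′ y′ c} → u ≐⟨ x , y ⟩ → w ≐⟨ x′ , y′ ⟩ →
               x ≢ x′ → x ≢ y′ → y ≢ x′ → y ≢ y′ → c ∈ᵥ u → ¬ c ∈ᵥ w
  ≐-disjoint p q x≢x′ x≢y′ y≢x′ y≢y′ c∈u with ≐-∈⁻ p c∈u
  ... | inj₁ refl = ≐-∉ q x≢x′ x≢y′
  ... | inj₂ refl = ≐-∉ q y≢x′ y≢y′

CEdge-neighbours : ∀ {m} {x y : Fin (suc m)} → CEdge x y → (y ≡ x ⊕ 1) ⊎ (y ≡ x ⊕ m)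
CEdge-neighbours (inj₁ y≡x⊕1) = inj₁ y≡x⊕1
CEdge-neighbours {y = y} (inj₂ refl) = inj₂ (sym (⊕-1-m y))

module _ {n : ℕ} where

  ≐⇒InL : ∀ {q} {v : Pair n} {i} → v ≐⟨ i , i ⊕ q ⟩ → InL q v
  ≐⇒InL {i = i} p = i , elements p

  InL⇒≐ : ∀ {q} {v : Pair n} → InL q v → ∃[ i ] v ≐⟨ i , i ⊕ q ⟩
  InL⇒≐ (i , p) = i , ≐-intro p

≐-offsets⇒InL : ∀ {m} {v : Pair (suc m)} (i : Fin (suc m)) (a : ℕ) {d} →
                v ≐⟨ i ⊕ a , i ⊕ (a + d) ⟩ → InL d v
≐-offsets⇒InL {v = v} i a {d} p = ≐⇒InL (≐-congʳ (sym (⊕-assoc i a d)) p)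

HasCard-tabulate : ∀ {n k} {P : Pair n → Set} (f : Fin k → Pair n) →
                   (∀ {i j} → f i ≡ f j → i ≡ j) → (∀ i → P (f i)) →
                   (∀ v → P v → ∃[ i ] v ≡ f i) → HasCard P k
HasCard-tabulate {P = P} f f-injective P-f onto =
  tabulate f , length-tabulate f , tabulate⁺ f-injective , λ v → mk⇔ (listed v) (satisfies v)
  where
    listed : ∀ v → P v → v ∈ tabulate f
    listed v Pv = let i , v≡fi = onto v Pv in subst (_∈ tabulate f) (sym v≡fi) (∈-tabulate⁺ i)
    satisfies : ∀ v → v ∈ tabulate f → P v
    satisfies v v∈ = let i , v≡fi = ∈-tabulate⁻ v∈ in subst P (sym v≡fi) (P-f i)

module OffsetPairs {m : ℕ} (q : ℕ) (0<q : 0 < q) (q<N : q < suc m) where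
  private
    N = suc m

  pairAt : Fin N → Pair N
  pairAt i = mkPair i (i ⊕ q) (⊕-≢-self i 0<q q<N ∘ sym)

  pairAt-≐ : (i : Fin N) → pairAt i ≐⟨ i , i ⊕ q ⟩
  pairAt-≐ i = mkPair-≐ _ _ _

  InL⇒pairAt : ∀ v → InL q v → ∃[ i ] v ≡ pairAt i
  InL⇒pairAt v L-v = let i , v≐ = InL⇒≐ {v = v} L-v in i , ≐-unique v≐ (pairAt-≐ i)

  pairAt-≡ : ∀ {i j} → pairAt i ≡ pairAt j → (i ≡ j) ⊎ (i ≡ j ⊕ q × j ≡ i ⊕ q)
  pairAt-≡ {i} {j} eq with ≐-∈⁻ (pairAt-≐ j) (subst (i ∈ᵥ_) eq (≐-∈ˡ (pairAt-≐ i)))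
  ... | inj₁ i≡j = inj₁ i≡j
  ... | inj₂ i≡j⊕q with ≐-∈⁻ (pairAt-≐ i) (subst (j ∈ᵥ_) (sym eq) (≐-∈ˡ (pairAt-≐ j)))
  ...   | inj₁ j≡i = inj₁ (sym j≡i)
  ...   | inj₂ j≡i⊕q = inj₂ (i≡j⊕q , j≡i⊕q)

module _ {m : ℕ} where
  private
    N = suc m

  L-nonempty : ∀ {q} → 0 < q → q < N → ∃[ v ] InL q v
  L-nonempty {q} 0<q q<N = pairAt 0ᶠ , ≐⇒InL (pairAt-≐ 0ᶠ)
    where open OffsetPairs q 0<q q<N

  L-card : ∀ {q} → 0 < q → q + q < N → HasCard (InL q) N
  L-card {q} 0<q 2q<N = HasCard-tabulate pairAt injective (λ i → ≐⇒InL (pairAt-≐ i)) InL⇒pairAt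
    where
      open OffsetPairs q 0<q (double≤⇒< 0<q (<⇒≤ 2q<N))
      injective : ∀ {i j} → pairAt i ≡ pairAt j → i ≡ j
      injective {i} eq with pairAt-≡ eq
      ... | inj₁ i≡j = i≡j
      ... | inj₂ (i≡j⊕q , j≡i⊕q) =
        ⊥-elim (⊕-≢-self i (+-mono-< 0<q 0<q) 2q<N
                 (trans (sym (⊕-assoc i q q)) (trans (cong (_⊕ q) (sym j≡i⊕q)) (sym i≡j⊕q))))

  -- When q + q = N each pair of L_q arises twice, so only the start points below q are used.
  L-card-half : ∀ {q} → 0 < q → q + q ≡ N → HasCard (InL q) q
  L-card-half {q} 0<q 2q≡N =
    HasCard-tabulate (pairAt ∘ ι) injective (λ k → ≐⇒InL (pairAt-≐ (ι k))) onto
    where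
      q<N : q < N
      q<N = double≤⇒< 0<q (≤-reflexive 2q≡N)
      open OffsetPairs q 0<q q<N
      q≤N : q ≤ N
      q≤N = <⇒≤ q<N
      ι : Fin q → Fin N
      ι k = inject≤ k q≤N
      toℕ-ι : ∀ k → toℕ (ι k) ≡ toℕ k
      toℕ-ι k = Fin.toℕ-inject≤ k q≤N

      injective : ∀ {k l} → pairAt (ι k) ≡ pairAt (ι l) → k ≡ l
      injective {k} {l} eq with pairAt-≡ eq
      ... | inj₁ ιk≡ιl = Fin.inject≤-injective q≤N q≤N k l ιk≡ιl
      ... | inj₂ (ιk≡ιl⊕q , _) = ⊥-elim (<⇒≱ (Fin.toℕ<n k) (begin
        q                      ≤⟨ m≤n+m q (toℕ l) ⟩
        toℕ l + q              ≡⟨ cong (_+ q) (toℕ-ι l) ⟨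
        toℕ (ι l) + q          ≡⟨ toℕ-⊕-< (ι l) l+q<N ⟨
        toℕ (ι l ⊕ q)          ≡⟨ cong toℕ ιk≡ιl⊕q ⟨
        toℕ (ι k)              ≡⟨ toℕ-ι k ⟩
        toℕ k                  ∎))
        where
          open ≤-Reasoning
          l+q<N : toℕ (ι l) + q < N
          l+q<N = subst (_< N) (cong (_+ q) (sym (toℕ-ι l)))
                    (subst (toℕ l + q <_) 2q≡N (+-monoˡ-< q (Fin.toℕ<n l)))

      below : ∀ {i} → (lt : toℕ i < q) → ι (fromℕ< lt) ≡ i
      below lt = Fin.toℕ-injective (trans (toℕ-ι (fromℕ< lt)) (Fin.toℕ-fromℕ< lt))

      onto : ∀ v → InL q v → ∃[ k ] v ≡ pairAt (ι k)
      onto v L-v with InL⇒pairAt v L-v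
      ... | i , v≡ with toℕ i <? q
      ...   | yes i<q = fromℕ< i<q , trans v≡ (cong pairAt (sym (below i<q)))
      ...   | no i≮q =
        fromℕ< j<q , trans v≡ (trans pairAt-i≡pairAt-j (cong pairAt (sym (below j<q))))
        where
          j = i ⊕ q
          j⊕q≡i : j ⊕ q ≡ i
          j⊕q≡i = trans (⊕-assoc i q q) (trans (cong (i ⊕_) 2q≡N) (⊕-period i))
          pairAt-i≡pairAt-j : pairAt i ≡ pairAt j
          pairAt-i≡pairAt-j = ≐-unique (pairAt-≐ i) (≐-sym (≐-congʳ j⊕q≡i (pairAt-≐ j)))
          t+q≡ : toℕ i + q ≡ toℕ i ∸ q + N
          t+q≡ = begin-equality
            toℕ i + q              ≡⟨ cong (_+ q) (m∸n+n≡m (≮⇒≥ i≮q)) ⟨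
            toℕ i ∸ q + q + q      ≡⟨ +-assoc (toℕ i ∸ q) q q ⟩
            toℕ i ∸ q + (q + q)    ≡⟨ cong (toℕ i ∸ q +_) 2q≡N ⟩
            toℕ i ∸ q + N          ∎
            where open ≤-Reasoning
          j<q : toℕ j < q
          j<q = begin-strict
            toℕ j                  ≡⟨ toℕ-⊕ i q ⟩
            (toℕ i + q) % N        ≡⟨ cong (_% N) t+q≡ ⟩
            (toℕ i ∸ q + N) % N    ≡⟨ [m+n]%n≡m%n (toℕ i ∸ q) N ⟩
            (toℕ i ∸ q) % N        ≤⟨ m%n≤m (toℕ i ∸ q) N ⟩
            toℕ i ∸ q              <⟨ m<n+o⇒m∸n<o (toℕ i) q {{>-nonZero 0<q}} i<q+q ⟩
            q                      ∎
            where
              open ≤-Reasoning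
              i<q+q : toℕ i < q + q
              i<q+q = subst (toℕ i <_) (sym 2q≡N) (Fin.toℕ<n i)

  InL-unique : ∀ {q q′} (v : Pair N) → 0 < q → 0 < q′ → q + q ≤ N → q′ + q′ ≤ N →
               InL q v → InL q′ v → q ≡ q′
  InL-unique {q} {q′} v 0<q 0<q′ 2q≤N 2q′≤N L-v L′-v
    with InL⇒≐ {v = v} L-v | InL⇒≐ {v = v} L′-v
  ... | i , p | j , p′ = cases (≐-∈⁻ p′ (≐-∈ˡ p)) (≐-∈⁻ p′ (≐-∈ʳ p))
    where
      q<N : q < N
      q<N = double≤⇒< 0<q 2q≤N
      q′<N : q′ < N
      q′<N = double≤⇒< 0<q′ 2q′≤N
      cases : (i ≡ j) ⊎ (i ≡ j ⊕ q′) → (i ⊕ q ≡ j) ⊎ (i ⊕ q ≡ j ⊕ q′) → q ≡ q′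
      cases (inj₁ refl) (inj₁ i⊕q≡i) = ⊥-elim (⊕-≢-self i 0<q q<N i⊕q≡i)
      cases (inj₁ refl) (inj₂ i⊕q≡i⊕q′) = ⊕-cancelˡ i q<N q′<N i⊕q≡i⊕q′
      cases (inj₂ refl) (inj₂ i⊕q≡i) = ⊥-elim (⊕-≢-self i 0<q q<N i⊕q≡i)
      cases (inj₂ refl) (inj₁ j⊕q′⊕q≡j) =
        halves-≡ 2q≤N 2q′≤N (∣⇒≤ {{>-nonZero (+-mono-< 0<q′ 0<q)}}
                               (⊕-fixed⇒∣ j (q′ + q) (trans (sym (⊕-assoc j q′ q)) j⊕q′⊕q≡j)))

  gap : Pair N → ℕ
  gap v = toℕ (snd v) ∸ toℕ (fst v)

  gap<N : (v : Pair N) → gap v < N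
  gap<N v = ≤-<-trans (m∸n≤m (toℕ (snd v)) (toℕ (fst v))) (Fin.toℕ<n (snd v))

  ≐-forward : (v : Pair N) → v ≐⟨ fst v , fst v ⊕ gap v ⟩
  ≐-forward v = ≐-congʳ (sym a⊕gap≡b) (≐-self v)
    where
      a+gap≡b : toℕ (fst v) + gap v ≡ toℕ (snd v)
      a+gap≡b = m+[n∸m]≡n (<⇒≤ (lt v))
      a⊕gap≡b : fst v ⊕ gap v ≡ snd v
      a⊕gap≡b = Fin.toℕ-injective
        (trans (toℕ-⊕-< (fst v) (subst (_< N) (sym a+gap≡b) (Fin.toℕ<n (snd v)))) a+gap≡b)

  ≐-backward : (v : Pair N) → v ≐⟨ snd v , snd v ⊕ (N ∸ gap v) ⟩
  ≐-backward v = ≐-congʳ (sym b⊕[N∸d]≡a) (≐-sym (≐-self v))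
    where
      a = toℕ (fst v)
      b = toℕ (snd v)
      d = gap v
      b+[N∸d]≡a+N : b + (N ∸ d) ≡ a + N
      b+[N∸d]≡a+N = begin
        b + (N ∸ d)         ≡⟨ cong (_+ (N ∸ d)) (m+[n∸m]≡n (<⇒≤ (lt v))) ⟨
        a + d + (N ∸ d)     ≡⟨ +-assoc a d (N ∸ d) ⟩
        a + (d + (N ∸ d))   ≡⟨ cong (a +_) (m+[n∸m]≡n (<⇒≤ (gap<N v))) ⟩
        a + N               ∎
        where open ≡-Reasoning
      b⊕[N∸d]≡a : snd v ⊕ (N ∸ d) ≡ fst v
      b⊕[N∸d]≡a = Fin.toℕ-injective (begin
        toℕ (snd v ⊕ (N ∸ d))  ≡⟨ toℕ-⊕ (snd v) (N ∸ d) ⟩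
        (b + (N ∸ d)) % N      ≡⟨ cong (_% N) b+[N∸d]≡a+N ⟩
        (a + N) % N            ≡⟨ [m+n]%n≡m%n a N ⟩
        a % N                  ≡⟨ m<n⇒m%n≡m (Fin.toℕ<n (fst v)) ⟩
        a                      ∎)
        where open ≡-Reasoning

  InL-cover : (v : Pair N) → ∃[ q ] (1 ≤ q × q ≤ N / 2 × InL q v)
  InL-cover v with gap v ≤? N / 2
  ... | yes gap≤half = gap v , m<n⇒0<n∸m (lt v) , gap≤half , ≐⇒InL (≐-forward v)
  ... | no gap≰half = N ∸ gap v , m<n⇒0<n∸m (gap<N v) , N∸gap≤half , ≐⇒InL (≐-backward v)
    where
      N∸gap≤half : N ∸ gap v ≤ N / 2
      N∸gap≤half = m≤n+o⇒m∸n≤o N (gap v) (begin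
        N                    ≤⟨ ≤suc-half+half N ⟩
        suc (N / 2 + N / 2)  ≡⟨ +-suc (N / 2) (N / 2) ⟨
        N / 2 + suc (N / 2)  ≤⟨ +-monoʳ-≤ (N / 2) (≰⇒> gap≰half) ⟩
        N / 2 + gap v        ≡⟨ +-comm (N / 2) (gap v) ⟩
        gap v + N / 2        ∎)
        where open ≤-Reasoning

HasDescendingSquare : ∀ {n} → ℕ → Pair n → Set
HasDescendingSquare q v =
  ∃[ B ] ∃[ C ] (B ≢ C × Adj v B × Adj v C × InL (q ∸ 1) B × InL (q ∸ 1) C
    × ∃[ w ] ((Adj B w × Adj C w × w ≢ v)
              × (∀ w′ → Adj B w′ → Adj C w′ → w′ ≢ v → w′ ≡ w)
              × InL (q ∸ 2) w))

module DescendingSquare {m : ℕ} (k : ℕ) (q+1<N : 4 + k < suc m) (i : Fin (suc m)) where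
  private
    N = suc m
    q = 3 + k

    o : ℕ → Fin N
    o a = i ⊕ a

    <N : ∀ {a} → a ≤ 4 + k → a < N
    <N a≤ = ≤-<-trans a≤ q+1<N

    o-≢ : ∀ {a b} → a ≤ 4 + k → b ≤ 4 + k → a ≢ b → o a ≢ o b
    o-≢ a≤ b≤ = ⊕-≢ i (<N a≤) (<N b≤)

    0≤ : 0 ≤ 4 + k
    0≤ = z≤n
    1≤ : 1 ≤ 4 + k
    1≤ = s≤s z≤n
    2≤ : 2 ≤ 4 + k
    2≤ = s≤s (s≤s z≤n)
    q-1≤ : 2 + k ≤ 4 + k
    q-1≤ = m≤n+m (2 + k) 2
    q≤ : q ≤ 4 + k
    q≤ = n≤1+n q

    q-1≢q : 2 + k ≢ q
    q-1≢q = m≢1+n+m (2 + k) {0}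
    q-1≢q+1 : 2 + k ≢ 4 + k
    q-1≢q+1 = m≢1+n+m (2 + k) {1}

    edge01 : CEdge (o 0) (o 1)
    edge01 = inj₁ (sym (⊕-suc i 0))

    edge-q : CEdge (o q) (o (2 + k))
    edge-q = inj₂ (sym (⊕-suc i (2 + k)))

    B C W : Pair N
    B = mkPair (o 1) (o q) (o-≢ 1≤ q≤ λ ())
    C = mkPair (o 0) (o (2 + k)) (o-≢ 0≤ q-1≤ λ ())
    W = mkPair (o 1) (o (2 + k)) (o-≢ 1≤ q-1≤ λ ())

    B≐ : B ≐⟨ o 1 , o q ⟩
    B≐ = mkPair-≐ _ _ _
    C≐ : C ≐⟨ o 0 , o (2 + k) ⟩
    C≐ = mkPair-≐ _ _ _
    W≐ : W ≐⟨ o 1 , o (2 + k) ⟩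
    W≐ = mkPair-≐ _ _ _

    ¬edge-0-q : ¬ CEdge (o 0) (o q)
    ¬edge-0-q e with CEdge-neighbours e
    ... | inj₁ oq≡o0⊕1 = o-≢ q≤ 1≤ (λ ()) (trans oq≡o0⊕1 (⊕-suc i 0))
    ... | inj₂ oq≡o0⊕m =
      ⊕-≢ i (<N q≤) ≤-refl (<⇒≢ (≤-pred q+1<N)) (trans oq≡o0⊕m (⊕-assoc i 0 m))

    -- Besides v and W, the neighbours of B are {o 1, o (q + 1)} and {o q, o 2}.
    ¬C~[1,q+1] : ∀ {w} → w ≐⟨ o 1 , o (4 + k) ⟩ → ¬ Adj C w
    ¬C~[1,q+1] {w} w≐ C~w =
      let c , c∈C , c∈w = Adj-common {u = C} {w = w} C~w
      in ≐-disjoint C≐ w≐ (o-≢ 0≤ 1≤ λ ()) (o-≢ 0≤ ≤-refl λ ()) (o-≢ q-1≤ 1≤ λ ())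
                    (o-≢ q-1≤ ≤-refl q-1≢q+1) c∈C c∈w

    ¬C~[q,2] : ∀ {w} → w ≐⟨ o q , o 2 ⟩ → ¬ Adj C w
    ¬C~[q,2] {w} w≐ C~w with Adj-cases {w = w} C≐ C~w
    ... | _ , inj₁ (_ , w≐′) = ≐-∉ w≐ (o-≢ 0≤ q≤ λ ()) (o-≢ 0≤ 2≤ λ ()) (≐-∈ˡ w≐′)
    ... | y , inj₂ (e , w≐′) = ¬edge-0-q (subst (CEdge (o 0)) (sym oq≡y) e)
      where
        oq≡y : o q ≡ y
        oq≡y = ≐-other w≐′ (≐-∈ˡ w≐) (o-≢ q≤ q-1≤ (q-1≢q ∘ sym))

  descendingSquare : (v : Pair N) → v ≐⟨ i , i ⊕ q ⟩ → HasDescendingSquare q v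
  descendingSquare v v≐i =
    B , C , B≢C , Adj-intro edge01 (o-≢ 0≤ 1≤ λ ()) (≐-sym v≐) (≐-sym B≐)
    , Adj-intro edge-q (o-≢ q≤ q-1≤ (q-1≢q ∘ sym)) v≐ C≐
    , ≐-offsets⇒InL i 1 B≐ , ≐-offsets⇒InL i 0 C≐
    , W , (Adj-intro edge-q (o-≢ q≤ q-1≤ (q-1≢q ∘ sym)) B≐ W≐
          , Adj-intro edge01 (o-≢ 0≤ 1≤ λ ()) (≐-sym C≐) (≐-sym W≐) , W≢v)
    , unique , ≐-offsets⇒InL i 1 W≐
    where
      v≐ : v ≐⟨ o 0 , o q ⟩
      v≐ = ≐-sym (≐-congʳ (sym (⊕-identityʳ i)) (≐-sym v≐i))

      B≢C : B ≢ C
      B≢C = ∈∧∉⇒≢ (≐-∈ˡ B≐) (≐-∉ C≐ (o-≢ 1≤ 0≤ λ ()) (o-≢ 1≤ q-1≤ λ ()))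

      W≢v : W ≢ v
      W≢v = ∈∧∉⇒≢ (≐-∈ˡ W≐) (≐-∉ v≐ (o-≢ 1≤ 0≤ λ ()) (o-≢ 1≤ q≤ λ ()))

      unique : ∀ w′ → Adj B w′ → Adj C w′ → w′ ≢ v → w′ ≡ W
      unique w′ B~w′ C~w′ w′≢v with Adj-cases {w = w′} B≐ B~w′
      ... | _ , inj₁ (e , w′≐) with CEdge-neighbours e
      ...   | inj₁ refl = ⊥-elim (¬C~[1,q+1] (≐-congʳ (⊕-suc i q) w′≐) C~w′)
      ...   | inj₂ refl = ≐-unique (≐-congʳ (⊕-pred i (2 + k)) w′≐) W≐
      unique w′ B~w′ C~w′ w′≢v | _ , inj₂ (e , w′≐) with CEdge-neighbours e
      ...   | inj₁ refl = ⊥-elim (¬C~[q,2] (≐-congʳ (⊕-suc i 1) w′≐) C~w′)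
      ...   | inj₂ refl = ⊥-elim (w′≢v (≐-unique (≐-congʳ (⊕-pred i 0) w′≐) (≐-sym v≐)))

length≡2⇒¬distinct₃ : ∀ {A : Set} {xs : List A} {a b c : A} → length xs ≡ 2 →
                      a ∈ xs → b ∈ xs → c ∈ xs → a ≢ b → a ≢ c → b ≢ c → ⊥
length≡2⇒¬distinct₃ {xs = x ∷ y ∷ []} refl a∈ b∈ c∈ a≢b a≢c b≢c
  with one-of a∈ | one-of b∈ | one-of c∈
  where
    one-of : ∀ {z} → z ∈ x ∷ y ∷ [] → (z ≡ x) ⊎ (z ≡ y)
    one-of (here z≡x) = inj₁ z≡x
    one-of (there (here z≡y)) = inj₂ z≡y
... | inj₁ refl | inj₁ refl | _         = a≢b refl
... | inj₂ refl | inj₂ refl | _         = a≢b refl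
... | inj₁ refl | _         | inj₁ refl = a≢c refl
... | inj₂ refl | _         | inj₂ refl = a≢c refl
... | _         | inj₁ refl | inj₁ refl = b≢c refl
... | _         | inj₂ refl | inj₂ refl = b≢c refl

module _ {k : ℕ} where
  private
    m = 2 + k
    N = suc m

    ≢⊕1 : (i : Fin N) → i ≢ i ⊕ 1
    ≢⊕1 i = ⊕-≢-self i (s≤s z≤n) (s≤s (s≤s z≤n)) ∘ sym

    ≢⊕m : (i : Fin N) → i ≢ i ⊕ m
    ≢⊕m i = ⊕-≢-self i (s≤s z≤n) ≤-refl ∘ sym

    ⊕1≢⊕m : (i : Fin N) → i ⊕ 1 ≢ i ⊕ m
    ⊕1≢⊕m i = ⊕-≢ i (s≤s (s≤s z≤n)) ≤-refl λ ()

  L₁⇒degree-2 : (v : Pair N) → InL 1 v → HasDegree v 2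
  L₁⇒degree-2 v L₁v with InL⇒≐ {v = v} L₁v
  ... | i , v≐ =
    P₁ ∷ P₂ ∷ [] , refl , (P₁≢P₂ ∷ []) ∷ [] ∷ [] , λ w → mk⇔ (listed w) (adjacent w)
    where
      P₁ P₂ : Pair N
      P₁ = mkPair (i ⊕ 1) (i ⊕ m) (⊕1≢⊕m i)
      P₂ = mkPair i (i ⊕ 2) (⊕-≢-self i (s≤s z≤n) (s≤s (s≤s (s≤s z≤n))) ∘ sym)
      P₁≐ : P₁ ≐⟨ i ⊕ 1 , i ⊕ m ⟩
      P₁≐ = mkPair-≐ _ _ _
      P₂≐ : P₂ ≐⟨ i , i ⊕ 2 ⟩
      P₂≐ = mkPair-≐ _ _ _

      P₁≢P₂ : P₁ ≢ P₂
      P₁≢P₂ = ≢-sym (∈∧∉⇒≢ (≐-∈ˡ P₂≐) (≐-∉ P₁≐ (≢⊕1 i) (≢⊕m i)))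

      adjacent : ∀ w → w ∈ P₁ ∷ P₂ ∷ [] → Adj v w
      adjacent w (here refl) = Adj-intro (inj₂ (sym (⊕-m-1 i))) (≢⊕m i) (≐-sym v≐) P₁≐
      adjacent w (there (here refl)) = Adj-intro (inj₁ (sym (⊕-suc i 1))) i⊕1≢i⊕2 v≐ P₂≐
        where
          i⊕1≢i⊕2 : i ⊕ 1 ≢ i ⊕ 2
          i⊕1≢i⊕2 = ⊕-≢ i (s≤s (s≤s z≤n)) (s≤s (s≤s (s≤s z≤n))) λ ()

      listed : ∀ w → Adj v w → w ∈ P₁ ∷ P₂ ∷ []
      listed w v~w with Adj-cases {w = w} v≐ v~w
      ... | _ , inj₁ (e , w≐) with CEdge-neighbours e
      ...   | inj₁ refl = there (here (≐-unique (≐-congʳ (⊕-suc i 1) w≐) P₂≐))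
      ...   | inj₂ refl = ⊥-elim (≐-distinct w≐ (sym (⊕-1-m i)))
      listed w v~w | _ , inj₂ (e , w≐) with CEdge-neighbours e
      ...   | inj₁ refl = ⊥-elim (≐-distinct w≐ refl)
      ...   | inj₂ refl = here (≐-unique w≐ P₁≐)

  non-edge⇒three-neighbours : (v : Pair N) → snd v ≢ fst v ⊕ 1 → fst v ≢ snd v ⊕ 1 →
    ∃[ W₁ ] ∃[ W₂ ] ∃[ W₃ ] ((Adj v W₁ × Adj v W₂ × Adj v W₃)
                             × (W₁ ≢ W₂ × W₁ ≢ W₃ × W₂ ≢ W₃))
  non-edge⇒three-neighbours v b≢a⊕1 a≢b⊕1 =
    W₁ , W₂ , W₃ , (v~W₁ , v~W₂ , v~W₃) , (W₁≢W₂ , W₁≢W₃ , W₂≢W₃)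
    where
      a = fst v
      b = snd v
      a≢b : a ≢ b
      a≢b = Fin.<⇒≢ (lt v)
      b≢a⊕m : b ≢ a ⊕ m
      b≢a⊕m b≡a⊕m = a≢b⊕1 (sym (trans (cong (_⊕ 1) b≡a⊕m) (⊕-m-1 a)))

      W₁ W₂ W₃ : Pair N
      W₁ = mkPair b (a ⊕ 1) b≢a⊕1
      W₂ = mkPair b (a ⊕ m) b≢a⊕m
      W₃ = mkPair a (b ⊕ 1) a≢b⊕1
      W₁≐ : W₁ ≐⟨ b , a ⊕ 1 ⟩
      W₁≐ = mkPair-≐ _ _ _
      W₂≐ : W₂ ≐⟨ b , a ⊕ m ⟩
      W₂≐ = mkPair-≐ _ _ _
      W₃≐ : W₃ ≐⟨ a , b ⊕ 1 ⟩
      W₃≐ = mkPair-≐ _ _ _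

      v~W₁ : Adj v W₁
      v~W₁ = Adj-intro (inj₁ refl) (≢⊕1 a) (≐-sym (≐-self v)) W₁≐
      v~W₂ : Adj v W₂
      v~W₂ = Adj-intro (inj₂ (sym (⊕-m-1 a))) (≢⊕m a) (≐-sym (≐-self v)) W₂≐
      v~W₃ : Adj v W₃
      v~W₃ = Adj-intro (inj₁ refl) (≢⊕1 b) (≐-self v) W₃≐

      W₁≢W₂ : W₁ ≢ W₂
      W₁≢W₂ = ∈∧∉⇒≢ (≐-∈ʳ W₁≐) (≐-∉ W₂≐ (b≢a⊕1 ∘ sym) (⊕1≢⊕m a))
      W₁≢W₃ : W₁ ≢ W₃
      W₁≢W₃ = ≢-sym (∈∧∉⇒≢ (≐-∈ˡ W₃≐) (≐-∉ W₁≐ a≢b (≢⊕1 a)))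
      W₂≢W₃ : W₂ ≢ W₃
      W₂≢W₃ = ≢-sym (∈∧∉⇒≢ (≐-∈ˡ W₃≐) (≐-∉ W₂≐ a≢b (≢⊕m a)))

  degree-2⇒L₁ : (v : Pair N) → HasDegree v 2 → InL 1 v
  degree-2⇒L₁ v (xs , length≡2 , _ , adj⇔)
    with snd v Fin.≟ fst v ⊕ 1 | fst v Fin.≟ snd v ⊕ 1
  ... | yes b≡a⊕1 | _ = ≐⇒InL (≐-congʳ b≡a⊕1 (≐-self v))
  ... | no _ | yes a≡b⊕1 = ≐⇒InL (≐-congʳ a≡b⊕1 (≐-sym (≐-self v)))
  ... | no b≢a⊕1 | no a≢b⊕1 with non-edge⇒three-neighbours v b≢a⊕1 a≢b⊕1
  ...   | _ , _ , _ , (v~W₁ , v~W₂ , v~W₃) , W₁≢W₂ , W₁≢W₃ , W₂≢W₃ =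
    ⊥-elim (length≡2⇒¬distinct₃ length≡2 (listed v~W₁) (listed v~W₂) (listed v~W₃)
                                W₁≢W₂ W₁≢W₃ W₂≢W₃)
    where
      listed : ∀ {w} → Adj v w → w ∈ xs
      listed {w} = to (adj⇔ w)

mainTheorem5 : (n : ℕ) → 3 ≤ n →
    -- (1)
    (2 ∣ n → HasCard {n} (InL (n / 2)) (n / 2)
             × (∀ q → 1 ≤ q → q < n / 2 → HasCard {n} (InL q) n))
    -- (2)
    × (¬ (2 ∣ n) → ∀ q → 1 ≤ q → q ≤ n / 2 → HasCard {n} (InL q) n)
    -- (3) {L_1,…,L_r} is a partition of V(F_2(C_n))
    × ((∀ q → 1 ≤ q → q ≤ n / 2 → ∃[ v ] InL {n} q v)
       × (∀ (v : Pair n) → ∃[ q ] (1 ≤ q × q ≤ n / 2 × InL q v))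
       × (∀ q q′ (v : Pair n) → 1 ≤ q → q ≤ n / 2 → 1 ≤ q′ → q′ ≤ n / 2 →
            InL q v → InL q′ v → q ≡ q′))
    -- (4)
    × (6 ≤ n → ∀ q → 3 ≤ q → q ≤ n / 2 → ∀ (v : Pair n) (i : Fin n) →
         (∀ x → x ∈ᵥ v ⇔ ((x ≡ i) ⊎ (x ≡ i ⊕ q))) →
         ∃[ B ] ∃[ C ] (B ≢ C × Adj v B × Adj v C
           × InL (q ∸ 1) B × InL (q ∸ 1) C
           × ∃[ w ] ((Adj B w × Adj C w × w ≢ v)
               × (∀ w′ → Adj B w′ → Adj C w′ → w′ ≢ v → w′ ≡ w)
               × InL (q ∸ 2) w)))
    -- (5)
    × (∀ (v : Pair n) → HasDegree v 2 ⇔ InL 1 v)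
mainTheorem5 n@(suc (suc (suc k))) (s≤s (s≤s (s≤s z≤n))) =
    (λ 2∣n → L-card-half 1≤half (even⇒half+half≡ n 2∣n)
           , λ q 1≤q q<half → L-card 1≤q (<half⇒double< n q<half))
  , (λ 2∤n q 1≤q q≤half → L-card 1≤q (odd∧≤half⇒double< n 2∤n q≤half))
  , ( (λ q 1≤q q≤half → L-nonempty 1≤q (double≤⇒< 1≤q (≤half⇒double≤ n q≤half)))
    , InL-cover
    , λ q q′ v 1≤q q≤half 1≤q′ q′≤half →
        InL-unique v 1≤q 1≤q′ (≤half⇒double≤ n q≤half) (≤half⇒double≤ n q′≤half))
  , square
  , λ v → mk⇔ (degree-2⇒L₁ v) (L₁⇒degree-2 v)
  where
    1≤half : 1 ≤ n / 2
    1≤half = m≥n⇒m/n>0 {n} (s≤s (s≤s z≤n))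

    -- The hypothesis 6 ≤ n is implied by 3 ≤ q ≤ n / 2.
    square : 6 ≤ n → ∀ q → 3 ≤ q → q ≤ n / 2 → ∀ (v : Pair n) (i : Fin n) →
             (∀ x → x ∈ᵥ v ⇔ ((x ≡ i) ⊎ (x ≡ i ⊕ q))) → HasDescendingSquare q v
    square _ q@(suc (suc (suc k′))) (s≤s (s≤s (s≤s z≤n))) q≤half v i v≐ =
      DescendingSquare.descendingSquare k′ q+1<n i v (≐-intro v≐)
      where
        q+1<n : suc q < n
        q+1<n = <-≤-trans (subst (_< q + q) (+-comm q 1) (+-monoʳ-< q (s≤s (s≤s z≤n))))
                          (≤half⇒double≤ n q≤half)
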